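{- Let $n\geq 2$. The class $\mathcal{PO}_{n,<_1,\ldots,<_n}$ of all finite $n$-dimensional partial orders with realizers has the Ramsey property: for all $\mathbf{A},\mathbf{B}\in\mathcal{PO}_{n,<_1,\ldots,<_n}$ with $\mathbf{A}$ embeddable in $\mathbf{B}$ and every $k\in\mathbb{N}^+$, there is $\mathbf{C}\in\mathcal{PO}_{n,<_1,\ldots,<_n}$ into which $\mathbf{B}$ embeds such that for every colouring $c:\binom{\mathbf{C}}{\mathbf{A}}\to\{1,\ldots,k\}$ there is $\mathbf{B}_0\in\binom{\mathbf{C}}{\mathbf{B}}$ with $c$ constant on $\binom{\mathbf{B}_0}{\mathbf{A}}$.
   Context: An $n$-dimensional partial order with realizers is a structure $(P,<,<_1,\ldots,<_n)$, $P\neq\emptyset$, with each $<_i$ a strict linear order on $P$ and $a<b$ iff $a<_i b$ for all $i\leq n$. $\mathcal{PO}_{n,<_1,\ldots,<_n}$ is the class of finite such structures. Embeddings are injective maps preserving and reflecting all $n+1$ relations; substructures are subsets with the induced relations. For structures $\mathbf{A},\mathbf{B}$, $\binom{\mathbf{B}}{\mathbf{A}}$ denotes the set of substructures of $\mathbf{B}$ isomorphic to $\mathbf{A}$. -}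

module Defs where

open import Data.Nat using (ℕ; suc)
open import Data.Fin using (Fin)
open import Data.Fin.Subset using (Subset; _⊆_)
open import Data.Fin.Properties using (any?)
open import Data.Vec using (tabulate)
open import Data.Product using (Σ; _×_)
open import Function.Bundles using (_⇔_)
open import Function.Definitions using (Injective)
open import Relation.Binary.Core using (Rel)
open import Relation.Binary.Structures using (IsStrictTotalOrder)
open import Relation.Binary.PropositionalEquality using (_≡_)
open import Relation.Nullary.Decidable using (does)
open import Data.Fin using (_≟_)
open import Level using (0ℓ)

-- A finite n-dimensional partial order with realizers (P,<,<_1,…,<_n).
-- The (nonempty) carrier is Fin (suc size); realizers are indexed by Fin n.
record PO (n : ℕ) : Set₁ where
  field
    size     : ℕ
    realizer : Fin n → Rel (Fin (suc size)) 0ℓ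
    isLinear : (i : Fin n) → IsStrictTotalOrder _≡_ (realizer i)

  Carrier : Set
  Carrier = Fin (suc size)

  _<_ : Rel Carrier 0ℓ
  a < b = (i : Fin n) → realizer i a b

open PO public

record Embedding {n : ℕ} (A B : PO n) : Set where
  field
    fun       : Carrier A → Carrier B
    injective : Injective _≡_ _≡_ fun
    pres-<    : ∀ x y → (_<_ A x y ⇔ _<_ B (fun x) (fun y))
    pres-i    : ∀ (i : Fin n) x y → (realizer A i x y ⇔ realizer B i (fun x) (fun y))

open Embedding public

image : ∀ {n} {A B : PO n} → Embedding A B → Subset (suc (size B))
image {A = A} f = tabulate (λ y → does (any? (λ x → fun f x ≟ y)))

-- S ∈ (C choose A): S is a substructure of C isomorphic to A,
-- i.e. S is the image of an embedding of A into C.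
Copy : ∀ {n} (A C : PO n) → Subset (suc (size C)) → Set
Copy A C S = Σ (Embedding A C) (λ f → image f ≡ S)

module Submission where

-- The witness C is a grid: its points are the maps p : Fin n → {0,…,N}, and its i-th realizer
-- orders points lexicographically, by the coordinate p i first.  A strictly increasing sequence s
-- of length n·|D| places any D in the grid: cut s into n blocks of length |D| and send x to the
-- point whose i-th coordinate is the entry of block i at the position of x in <ᵢ.  If D′ is placed
-- by s, every copy of A inside it is placed by a subsequence of s of length n·|A|: the copy is an
-- embedding A → D′, so in each block it picks |A| entries, in order.  Colour the n·|A|-subsequences
-- of 0, …, N by the colour of the copy of A they place; Ramsey's theorem yields a homogeneous
-- subsequence of length n·|B|, and the copy of B it places is B₀.

open import Defs hiding (_<_)
open import Data.Bool using (true; false)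
open import Data.Fin
  using (Fin; zero; suc; toℕ; fromℕ<; cast; inject≤; combine; remQuot; punchOut; _≟_)
  renaming (_<_ to _<ᶠ_)
open import Data.Fin.Properties
  using ( any?; toℕ-fromℕ<; toℕ-injective; toℕ<n; toℕ-cast; toℕ-inject≤; toℕ-combine
        ; combine-monoˡ-<; combine-injectiveʳ; combine-remQuot; remQuot-combine
        ; <-cmp; <-irrefl; <-asym; <⇒≢; injective⇒≤; punchOut-injective; punchIn-punchOut )
open import Data.Fin.Subset using (Subset; _∈_; _⊆_; _⊂_; ⊤; ∣_∣)
open import Data.Fin.Subset.Properties using (p⊂q⇒∣p∣<∣q∣; ∣⊤∣≡n; ∈⊤)
open import Data.List using (List; []; _∷_; length; map; filter; take; lookup; tabulate; allFin)
open import Data.List.Properties using (length-map; length-take; length-tabulate; lookup-tabulate)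
import Data.List.Properties as List
open import Data.List.Membership.Propositional.Properties using (∈-lookup)
open import Data.List.Relation.Unary.All as All using (All; []; _∷_)
open import Data.List.Relation.Unary.All.Properties using (all-filter)
open import Data.List.Relation.Unary.AllPairs using (AllPairs; []; _∷_)
open import Data.List.Relation.Unary.AllPairs.Properties using (tabulate⁺-<)
open import Data.List.Relation.Binary.Sublist.Propositional
  using ([]; _∷_; _∷ʳ_; ⊆-trans; minimum) renaming (_⊆_ to _⊑_)
open import Data.List.Relation.Binary.Sublist.Propositional.Properties
  using (All-resp-⊆; map⁺; filter-⊆; take-⊆)
open import Data.Nat using (ℕ; zero; suc; _+_; _*_; _≤_; _<_; _≤?_; s≤s)
import Data.Nat as ℕ
import Data.Nat.Properties as ℕ
open import Data.Product using (Σ; ∃; ∃-syntax; _×_; _,_; proj₁; proj₂; uncurry)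
import Data.Vec as Vec
import Data.Vec.Properties as Vec
open import Function using (_∘_; _on_; id; case_of_; _⇔_; mk⇔; Equivalence)
open import Function.Definitions using (Injective; Surjective)
open import Level using (Level; 0ℓ)
open import Relation.Binary.Core using (Rel; _Preserves_⟶_)
open import Relation.Binary.Definitions using (Trichotomous; tri<; tri≈; tri>)
open import Relation.Binary.Structures using (IsStrictTotalOrder)
open import Relation.Binary.PropositionalEquality
  using ( _≡_; _≢_; refl; sym; trans; cong; cong₂; subst; subst₂; _≗_; isEquivalence
        ; module ≡-Reasoning )
open import Relation.Nullary using (yes; no; does; proof; ¬?; contradiction)
open import Relation.Nullary.Decidable using (dec-true; does-⇔)
open import Relation.Nullary.Reflects using (Reflects; invert)
open import Relation.Unary using (Pred; Decidable)

private
  variable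
    ℓ : Level
    a b m n : ℕ
    X : Set

length-filter-partition : {P : Pred X ℓ} (P? : Decidable P) (xs : List X) →
  length (filter P? xs) + length (filter (¬? ∘ P?) xs) ≡ length xs
length-filter-partition P? []       = refl
length-filter-partition P? (x ∷ xs) with does (P? x)
... | true  = cong suc (length-filter-partition P? xs)
... | false = trans (ℕ.+-suc _ _) (cong suc (length-filter-partition P? xs))

take-⊑ : ∀ m (xs : List X) → m ≤ length xs → ∃[ ys ] ys ⊑ xs × length ys ≡ m
take-⊑ m xs m≤xs = take m xs , take-⊆ m xs , trans (length-take m xs) (ℕ.m≤n⇒m⊓n≡m m≤xs)

AllPairs-resp-⊑ : ∀ {R : Rel X ℓ} {xs ys} → AllPairs R ys → xs ⊑ ys → AllPairs R xs
AllPairs-resp-⊑ []           []         = []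
AllPairs-resp-⊑ (_ ∷ pairs)  (_ ∷ʳ τ)   = AllPairs-resp-⊑ pairs τ
AllPairs-resp-⊑ (x~ ∷ pairs) (refl ∷ τ) = All-resp-⊆ τ x~ ∷ AllPairs-resp-⊑ pairs τ

AllPairs⇒lookup-mono : ∀ {R : Rel X ℓ} {xs} → AllPairs R xs → lookup xs Preserves _<ᶠ_ ⟶ R
AllPairs⇒lookup-mono (x~ ∷ _)    {zero}  {suc j} _         = All.lookup x~ (∈-lookup j)
AllPairs⇒lookup-mono (_ ∷ pairs) {suc i} {suc j} (s≤s i<j) = AllPairs⇒lookup-mono pairs i<j

tabulate-lookup-⊑ : (xs : List X) (ι : Fin m → Fin (length xs)) → ι Preserves _<ᶠ_ ⟶ _<ᶠ_ →
  tabulate (lookup xs ∘ ι) ⊑ xs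

tabulate-lookup-∷-⊑ : ∀ {x} (xs : List X) (ι : Fin m → Fin (suc (length xs))) →
  (∀ p → zero ≢ ι p) → ι Preserves _<ᶠ_ ⟶ _<ᶠ_ → tabulate (lookup (x ∷ xs) ∘ ι) ⊑ xs
tabulate-lookup-∷-⊑ {x = x} xs ι ι≢0 ι-mono =
  subst (_⊑ xs) (List.tabulate-cong λ p → cong (lookup (x ∷ xs)) (punchIn-punchOut (ι≢0 p)))
    (tabulate-lookup-⊑ xs ι⁻ λ {p} {q} p<q → ℕ.s<s⁻¹ (subst₂ _<ᶠ_
      (sym (punchIn-punchOut (ι≢0 p))) (sym (punchIn-punchOut (ι≢0 q))) (ι-mono p<q)))
  where
  ι⁻ : Fin _ → Fin (length xs)
  ι⁻ p = punchOut (ι≢0 p)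

tabulate-lookup-⊑ {m = zero}  xs       ι _      = minimum xs
tabulate-lookup-⊑ {m = suc m} []       ι _      with () ← ι zero
tabulate-lookup-⊑ {m = suc m} (x ∷ xs) ι ι-mono = byHead (ι zero) refl
  where
  later≢0 : ∀ p → zero ≢ ι (suc p)
  later≢0 p 0≡ = ℕ.n≮0 (subst (λ z → toℕ (ι zero) < toℕ z) (sym 0≡) (ι-mono ℕ.z<s))
  byHead : ∀ j → ι zero ≡ j → tabulate (lookup (x ∷ xs) ∘ ι) ⊑ x ∷ xs
  byHead zero    ι₀≡0  =
    cong (lookup (x ∷ xs)) ι₀≡0 ∷ tabulate-lookup-∷-⊑ xs (ι ∘ suc) later≢0 (ι-mono ∘ ℕ.s<s)
  byHead (suc j) ι₀≡sj = x ∷ʳ tabulate-lookup-∷-⊑ xs ι ι≢0 ι-mono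
    where
    ι≢0 : ∀ p → zero ≢ ι p
    ι≢0 zero    0≡ = case trans 0≡ ι₀≡sj of λ ()
    ι≢0 (suc p)    = later≢0 p

-- Ramsey's theorem for sequences

module _ (colour : X → ℕ) where

  hasColour? : (col : ℕ) → Decidable (λ x → colour x ≡ col)
  hasColour? col x = colour x ℕ.≟ col

  pigeonhole : (K m : ℕ) (Q : List X) → All (λ x → colour x < K) Q → K * m < length Q →
    ∃[ col ] col < K × ∃[ Q′ ] Q′ ⊑ Q × length Q′ ≡ m × All (λ x → colour x ≡ col) Q′
  pigeonhole zero    m (x ∷ Q) (() ∷ _) _
  pigeonhole (suc K) m Q bounded large with m ≤? length (filter (hasColour? K) Q)
  ... | yes m≤top =
    let Q′ , τ , len = take-⊑ m _ m≤top
    in K , ℕ.≤-refl , Q′ , ⊆-trans τ (filter-⊆ (hasColour? K) Q) , len ,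
       All-resp-⊆ τ (all-filter (hasColour? K) Q)
  ... | no m≰top =
    let col , col<K , Q′ , τ , len , monochrome = pigeonhole K m rest restBounded restLarge
    in col , ℕ.m<n⇒m<1+n col<K , Q′ , ⊆-trans τ (filter-⊆ (¬? ∘ hasColour? K) Q) , len ,
       monochrome
    where
    rest : List X
    rest = filter (¬? ∘ hasColour? K) Q
    restBounded : All (λ x → colour x < K) rest
    restBounded = All.zipWith (λ (<1+K , ≢K) → ℕ.≤∧≢⇒< (ℕ.≤-pred <1+K) ≢K)
      (All-resp-⊆ (filter-⊆ (¬? ∘ hasColour? K) Q) bounded , all-filter (¬? ∘ hasColour? K) Q)
    restLarge : K * m < length rest
    restLarge = ℕ.≰⇒> λ rest≤ → ℕ.<-asym large (subst (_< m + K * m)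
      (length-filter-partition (hasColour? K) Q) (ℕ.+-mono-<-≤ (ℕ.≰⇒> m≰top) rest≤))

module _ {E : Set} where

  -- The length proof is irrelevant, so a colouring depends on the list alone.
  Colouring : ℕ → Set
  Colouring r = (T : List E) → .(length T ≡ r) → ℕ

  Bounded : ∀ {r} → ℕ → Colouring r → Set
  Bounded K χ = ∀ T .len → χ T len < K

  Homogeneous : ∀ {r} → Colouring r → List E → ℕ → Set
  Homogeneous {r} χ M col = ∀ T → T ⊑ M → (len : length T ≡ r) → χ T len ≡ col

  Homogeneous-resp-⊑ : ∀ {r} {χ : Colouring r} {M M′ col} →
    Homogeneous χ M col → M′ ⊑ M → Homogeneous χ M′ col
  Homogeneous-resp-⊑ hom σ T τ = hom T (⊆-trans τ σ)

  link : ∀ {r} → Colouring (suc r) → E → Colouring r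
  link χ x T len = χ (x ∷ T) (cong suc len)

  data EndHomogeneous {r} (χ : Colouring (suc r)) : List (E × ℕ) → Set where
    []  : EndHomogeneous χ []
    _∷_ : ∀ {x col Q} → Homogeneous (link χ x) (map proj₁ Q) col →
          EndHomogeneous χ Q → EndHomogeneous χ ((x , col) ∷ Q)

  EndHomogeneous-resp-⊑ : ∀ {r} {χ : Colouring (suc r)} {Q Q′} →
    EndHomogeneous χ Q → Q′ ⊑ Q → EndHomogeneous χ Q′
  EndHomogeneous-resp-⊑ eh         []         = eh
  EndHomogeneous-resp-⊑ (_ ∷ eh)   (_ ∷ʳ τ)   = EndHomogeneous-resp-⊑ eh τ
  EndHomogeneous-resp-⊑ (hom ∷ eh) (refl ∷ τ) =
    Homogeneous-resp-⊑ hom (map⁺ proj₁ τ) ∷ EndHomogeneous-resp-⊑ eh τ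

  endHomogeneous⇒homogeneous : ∀ {r} {χ : Colouring (suc r)} {Q col} →
    EndHomogeneous χ Q → All (λ q → proj₂ q ≡ col) Q → Homogeneous χ (map proj₁ Q) col
  endHomogeneous⇒homogeneous []        []         []      []         ()
  endHomogeneous⇒homogeneous (_ ∷ eh)  (_ ∷ mono) T       (_ ∷ʳ τ)   len =
    endHomogeneous⇒homogeneous eh mono T τ len
  endHomogeneous⇒homogeneous (hom ∷ _) (refl ∷ _) (_ ∷ T) (refl ∷ τ) len =
    hom T τ (ℕ.suc-injective len)

RamseyProperty : (r K m N : ℕ) → Set₁
RamseyProperty r K m N = ∀ {E} (L : List E) → N ≤ length L → (χ : Colouring r) → Bounded K χ →
  ∃[ M ] M ⊑ L × length M ≡ m × ∃[ col ] col < K × Homogeneous χ M col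

EndHomogeneousProperty : (r K p N : ℕ) → Set₁
EndHomogeneousProperty r K p N = ∀ {E} (L : List E) → N ≤ length L →
  (χ : Colouring (suc r)) → Bounded K χ →
  ∃[ Q ] map proj₁ Q ⊑ L × length Q ≡ p × All (λ q → proj₂ q < K) Q × EndHomogeneous χ Q

endHomogeneousSublist : ∀ {r K} → (∀ m → ∃[ N ] RamseyProperty r K m N) →
  ∀ p → ∃[ N ] EndHomogeneousProperty r K p N
endHomogeneousSublist ramsey-r zero    = zero , λ L _ _ _ → [] , minimum L , refl , [] , []
endHomogeneousSublist ramsey-r (suc p) =
  let Nₚ , sublist     = endHomogeneousSublist ramsey-r p
      N  , homogeneous = ramsey-r Nₚ
  in suc N , λ where
    (x ∷ L) (s≤s N≤L) χ bounded →
      let M , M⊑L , lenM , col , col<K , hom =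
            homogeneous L N≤L (link χ x) (λ T _ → bounded (x ∷ T) _)
          Q , Q⊑M , lenQ , Q<K , eh = sublist M (ℕ.≤-reflexive (sym lenM)) χ bounded
      in (x , col) ∷ Q , refl ∷ ⊆-trans Q⊑M M⊑L , cong suc lenQ , col<K ∷ Q<K ,
         Homogeneous-resp-⊑ hom Q⊑M ∷ eh

-- An end-homogeneous sequence of length K·m + 1 carries K colours on its elements; by pigeonhole
-- m of its elements carry the same one, and they form a homogeneous sequence.
ramsey : ∀ r K m → ∃[ N ] RamseyProperty r K m N
ramsey zero    K m = m , λ L m≤L χ bounded →
  let M , M⊑L , lenM = take-⊑ m L m≤L
  in M , M⊑L , lenM , χ [] refl , bounded [] refl , λ { [] _ _ → refl }
ramsey (suc r) K m =
  let N , sublist = endHomogeneousSublist (ramsey r K) (suc (K * m))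
  in N , λ L N≤L χ bounded →
    let Q , Q⊑L , lenQ , Q<K , eh = sublist L N≤L χ bounded
        col , col<K , Q′ , Q′⊑Q , lenQ′ , mono =
          pigeonhole proj₂ K m Q Q<K (ℕ.≤-reflexive (sym lenQ))
    in map proj₁ Q′ , ⊆-trans (map⁺ proj₁ Q′⊑Q) Q⊑L , trans (length-map proj₁ Q′) lenQ′ ,
       col , col<K , endHomogeneous⇒homogeneous (EndHomogeneous-resp-⊑ eh Q′⊑Q) mono

combine-monoʳ-< : ∀ (i : Fin m) {j j′ : Fin n} → j <ᶠ j′ → combine i j <ᶠ combine i j′
combine-monoʳ-< {n = n} i {j} {j′} j<j′ =
  subst₂ _<_ (sym (toℕ-combine i j)) (sym (toℕ-combine i j′)) (ℕ.+-monoʳ-< (n * toℕ i) j<j′)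

combine-cancelʳ-< : ∀ (i : Fin m) {j j′ : Fin n} → combine i j <ᶠ combine i j′ → j <ᶠ j′
combine-cancelʳ-< {n = n} i {j} {j′} lt = ℕ.+-cancelˡ-< (n * toℕ i) (toℕ j) (toℕ j′)
  (subst₂ _<_ (toℕ-combine i j) (toℕ-combine i j′) lt)

blockwise : (Fin n → Fin a → Fin b) → Fin (n * a) → Fin (n * b)
blockwise {a = a} φ p = uncurry (λ i j → combine i (φ i j)) (remQuot a p)

blockwise-combine : (φ : Fin n → Fin a → Fin b) (i : Fin n) (j : Fin a) →
  blockwise φ (combine i j) ≡ combine i (φ i j)
blockwise-combine φ i j = cong (uncurry (λ i j → combine i (φ i j))) (remQuot-combine i j)

blockwise-mono : (φ : Fin n → Fin a → Fin b) → (∀ i → φ i Preserves _<ᶠ_ ⟶ _<ᶠ_) →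
  blockwise φ Preserves _<ᶠ_ ⟶ _<ᶠ_
blockwise-mono {n = n} {a = a} φ φ-mono {p} {q} p<q =
  subst₂ _<ᶠ_ (cong (blockwise φ) (combine-remQuot {n} a p))
              (cong (blockwise φ) (combine-remQuot {n} a q))
    (onCombine (subst₂ _<ᶠ_ (sym (combine-remQuot {n} a p)) (sym (combine-remQuot {n} a q)) p<q))
  where
  onCombine : ∀ {i i′ j j′} → combine i j <ᶠ combine i′ j′ →
    blockwise φ (combine i j) <ᶠ blockwise φ (combine i′ j′)
  onCombine {i} {i′} {j} {j′} lt
    rewrite blockwise-combine φ i j | blockwise-combine φ i′ j′ with <-cmp i i′
  ... | tri< i<i′ _ _ = combine-monoˡ-< (φ i j) (φ i′ j′) i<i′
  ... | tri≈ _ refl _ = combine-monoʳ-< i (φ-mono i (combine-cancelʳ-< i lt))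
  ... | tri> _ _ i′<i = contradiction (combine-monoˡ-< j′ j i′<i) (<-asym lt)

cast-mono : .{eq : m ≡ n} → cast eq Preserves _<ᶠ_ ⟶ _<ᶠ_
cast-mono {eq = eq} {p} {q} = subst₂ _<_ (sym (toℕ-cast eq p)) (sym (toℕ-cast eq q))

injective⇒surjective : {f : Fin n → Fin n} → Injective _≡_ _≡_ f → Surjective _≡_ _≡_ f
injective⇒surjective {n = suc _} {f = f} f-inj y with any? (λ x → f x ≟ y)
... | yes (x , fx≡y) = x , λ { refl → fx≡y }
... | no ∄x = contradiction (injective⇒≤ punchOut∘f-injective) ℕ.1+n≰n
  where
  y≢f : ∀ x → y ≢ f x
  y≢f x y≡fx = ∄x (x , sym y≡fx)
  punchOut∘f-injective : Injective _≡_ _≡_ (λ x → punchOut (y≢f x))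
  punchOut∘f-injective = f-inj ∘ punchOut-injective (y≢f _) (y≢f _)

decSubset : {P : Pred (Fin n) ℓ} → Decidable P → Subset n
decSubset P? = Vec.tabulate (does ∘ P?)

∈-decSubset : {P : Pred (Fin n) ℓ} (P? : Decidable P) {x : Fin n} → x ∈ decSubset P? ⇔ P x
∈-decSubset {P = P} P? {x} = mk⇔
  (λ x∈ → invert (subst (Reflects (P x)) (trans (sym lookup-x) (Vec.[]=⇒lookup x∈))
                         (proof (P? x))))
  (λ Px → Vec.lookup⇒[]= x _ (trans lookup-x (dec-true (P? x) Px)))
  where
  lookup-x : Vec.lookup (decSubset P?) x ≡ does (P? x)
  lookup-x = Vec.lookup∘tabulate (does ∘ P?) x

imageOf : (Fin m → Fin n) → Subset n
imageOf u = decSubset (λ y → any? (λ x → u x ≟ y))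

∈-imageOf : (u : Fin m → Fin n) {y : Fin n} → y ∈ imageOf u ⇔ ∃ λ x → u x ≡ y
∈-imageOf u = ∈-decSubset (λ y → any? (λ x → u x ≟ y))

imageOf-cong : {u v : Fin m → Fin n} → u ≗ v → imageOf u ≡ imageOf v
imageOf-cong {u = u} {v} u≗v = Vec.tabulate-cong λ y → does-⇔
  (mk⇔ (λ (x , ux≡y) → x , trans (sym (u≗v x)) ux≡y) (λ (x , vx≡y) → x , trans (u≗v x) vx≡y))
  (any? (λ x → u x ≟ y)) (any? (λ x → v x ≟ y))

-- Ranks in a finite strict total order

module Rank {_≺_ : Rel (Fin n) 0ℓ} (≺-isStrictTotalOrder : IsStrictTotalOrder _≡_ _≺_) where
  open IsStrictTotalOrder ≺-isStrictTotalOrder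
    using (compare; irrefl; _<?_) renaming (trans to ≺-trans)

  below : Fin n → Subset n
  below x = decSubset (_<? x)

  ∈-below : ∀ {x y} → y ∈ below x ⇔ y ≺ x
  ∈-below {x} = ∈-decSubset (_<? x)

  below-⊂ : ∀ {x y} → x ≺ y → below x ⊂ below y
  below-⊂ x≺y = (λ z∈ → Equivalence.from ∈-below (≺-trans (Equivalence.to ∈-below z∈) x≺y)) ,
    _ , Equivalence.from ∈-below x≺y , irrefl refl ∘ Equivalence.to ∈-below

  below-⊂-⊤ : ∀ x → below x ⊂ ⊤
  below-⊂-⊤ x = (λ _ → ∈⊤) , x , ∈⊤ , irrefl refl ∘ Equivalence.to ∈-below

  rank : Fin n → Fin n
  rank x = fromℕ< (subst (∣ below x ∣ <_) (∣⊤∣≡n n) (p⊂q⇒∣p∣<∣q∣ (below-⊂-⊤ x)))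

  rank-mono : rank Preserves _≺_ ⟶ _<ᶠ_
  rank-mono x≺y =
    subst₂ _<_ (sym (toℕ-fromℕ< _)) (sym (toℕ-fromℕ< _)) (p⊂q⇒∣p∣<∣q∣ (below-⊂ x≺y))

  rank-injective : Injective _≡_ _≡_ rank
  rank-injective {x} {y} rx≡ry with compare x y
  ... | tri< x≺y _ _ = contradiction rx≡ry (<⇒≢ (rank-mono x≺y))
  ... | tri≈ _ x≡y _ = x≡y
  ... | tri> _ _ y≺x = contradiction (sym rx≡ry) (<⇒≢ (rank-mono y≺x))

  rank-cancel : ∀ {x y} → rank x <ᶠ rank y → x ≺ y
  rank-cancel {x} {y} rx<ry with compare x y
  ... | tri< x≺y _ _  = x≺y
  ... | tri≈ _ refl _ = contradiction rx<ry (<-irrefl refl)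
  ... | tri> _ _ y≺x  = contradiction (rank-mono y≺x) (<-asym rx<ry)

  unrank : Fin n → Fin n
  unrank j = proj₁ (injective⇒surjective rank-injective j)

  rank-unrank : ∀ j → rank (unrank j) ≡ j
  rank-unrank j = proj₂ (injective⇒surjective rank-injective j) refl

  unrank-rank : ∀ x → unrank (rank x) ≡ x
  unrank-rank x = rank-injective (rank-unrank (rank x))

  unrank-mono : unrank Preserves _<ᶠ_ ⟶ _≺_
  unrank-mono {i} {j} i<j =
    rank-cancel (subst₂ _<ᶠ_ (sym (rank-unrank i)) (sym (rank-unrank j)) i<j)

rank : (D : PO n) (i : Fin n) → Carrier D → Carrier D
rank D i = Rank.rank (isLinear D i)

on-injective-isStrictTotalOrder : (f : X → Fin m) → Injective _≡_ _≡_ f →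
  IsStrictTotalOrder _≡_ (_<ᶠ_ on f)
on-injective-isStrictTotalOrder f f-inj = record
  { isStrictPartialOrder = record
    { isEquivalence = isEquivalence
    ; irrefl        = λ { refl → <-irrefl refl }
    ; trans         = ℕ.<-trans
    ; <-resp-≈      = (λ { refl → id }) , (λ { refl → id })
    }
  ; compare = compareOn
  }
  where
  compareOn : Trichotomous _≡_ (_<ᶠ_ on f)
  compareOn x y with <-cmp (f x) (f y)
  ... | tri< lt ≢ ≯ = tri< lt (≢ ∘ cong f) ≯
  ... | tri≈ ≮ eq ≯ = tri≈ ≮ (f-inj eq) ≯
  ... | tri> ≮ ≢ gt = tri> ≮ (≢ ∘ cong f) gt

-- The grid

module Grid (N : ℕ) where

  -- suc (gridSize n) = (suc N) ^ n
  gridSize : ℕ → ℕ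
  gridSize zero    = 0
  gridSize (suc n) = gridSize n + N * suc (gridSize n)

  encode : (Fin n → Fin (suc N)) → Fin (suc (gridSize n))
  encode {zero}  p = zero
  encode {suc n} p = combine (p zero) (encode (p ∘ suc))

  decode : Fin (suc (gridSize n)) → Fin n → Fin (suc N)
  decode {suc n} x zero    = proj₁ (remQuot {suc N} (suc (gridSize n)) x)
  decode {suc n} x (suc i) = decode (proj₂ (remQuot {suc N} (suc (gridSize n)) x)) i

  decode-encode : (p : Fin n → Fin (suc N)) (i : Fin n) → decode (encode p) i ≡ p i
  decode-encode {suc n} p zero    =
    cong proj₁ (remQuot-combine {suc N} {suc (gridSize n)} (p zero) (encode (p ∘ suc)))
  decode-encode {suc n} p (suc i) = trans
    (cong (λ x → decode (proj₂ x) i)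
          (remQuot-combine {suc N} {suc (gridSize n)} (p zero) (encode (p ∘ suc))))
    (decode-encode (p ∘ suc) i)

  encode-cong : {p q : Fin n → Fin (suc N)} → p ≗ q → encode p ≡ encode q
  encode-cong {zero}  _   = refl
  encode-cong {suc n} p≗q = cong₂ combine (p≗q zero) (encode-cong (p≗q ∘ suc))

  -- Coordinate i first; ties are broken by the whole point, which makes the order total.
  lexKey : Fin n → Fin (suc (gridSize n)) → Fin (suc N * suc (gridSize n))
  lexKey i x = combine (decode x i) x

  grid : (n : ℕ) → PO n
  grid n = record
    { size     = gridSize n
    ; realizer = λ i → _<ᶠ_ on lexKey i
    ; isLinear = λ i → on-injective-isStrictTotalOrder (lexKey i)
                         (λ {x} {y} → combine-injectiveʳ (decode x i) x (decode y i) y)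
    }

  module _ (D : PO n) where

    gridMap : (Fin n → Carrier D → Fin (suc N)) → Carrier D → Carrier (grid n)
    gridMap Y x = encode (λ i → Y i x)

    gridEmbedding : Fin n → (Y : Fin n → Carrier D → Fin (suc N)) →
      (∀ i → Y i Preserves realizer D i ⟶ _<ᶠ_) → Embedding D (grid n)
    gridEmbedding i₀ Y Y-mono = record
      { fun       = gridMap Y
      ; injective = gridMap-injective
      ; pres-<    = λ x y → mk⇔ (λ x<y i → preserves i (x<y i)) (λ x<y i → reflects i (x<y i))
      ; pres-i    = λ i x y → mk⇔ (preserves i) (reflects i)
      }
      where
      preserves : ∀ i → gridMap Y Preserves realizer D i ⟶ realizer (grid n) i
      preserves i {x} {y} x<y = combine-monoˡ-< (gridMap Y x) (gridMap Y y)
        (subst₂ _<ᶠ_ (sym (decode-encode _ i)) (sym (decode-encode _ i)) (Y-mono i x<y))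
      reflects : ∀ i {x y} → realizer (grid n) i (gridMap Y x) (gridMap Y y) → realizer D i x y
      reflects i {x} {y} gx<gy with IsStrictTotalOrder.compare (isLinear D i) x y
      ... | tri< x<y _ _  = x<y
      ... | tri≈ _ refl _ = contradiction gx<gy (<-irrefl refl)
      ... | tri> _ _ y<x  = contradiction (preserves i y<x) (<-asym gx<gy)
      gridMap-injective : Injective _≡_ _≡_ (gridMap Y)
      gridMap-injective {x} {y} gx≡gy with IsStrictTotalOrder.compare (isLinear D i₀) x y
      ... | tri< x<y _ _ = contradiction (cong (lexKey i₀) gx≡gy) (<⇒≢ (preserves i₀ x<y))
      ... | tri≈ _ x≡y _ = x≡y
      ... | tri> _ _ y<x = contradiction (cong (lexKey i₀) (sym gx≡gy)) (<⇒≢ (preserves i₀ y<x))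

    blockCoordinates : (Fin (n * suc (size D)) → Fin (suc N)) → Fin n → Carrier D → Fin (suc N)
    blockCoordinates s i x = s (combine i (rank D i x))

    gridMap-blockCoordinates-cong : ∀ {s t} → s ≗ t →
      gridMap (blockCoordinates s) ≗ gridMap (blockCoordinates t)
    gridMap-blockCoordinates-cong s≗t x = encode-cong (λ i → s≗t (combine i (rank D i x)))

    gridCopy : Fin n → (s : Fin (n * suc (size D)) → Fin (suc N)) → s Preserves _<ᶠ_ ⟶ _<ᶠ_ →
      Embedding D (grid n)
    gridCopy i₀ s s-mono = gridEmbedding i₀ (blockCoordinates s)
      (λ i → s-mono ∘ combine-monoʳ-< i ∘ Rank.rank-mono (isLinear D i))

  Subsequence : {A B : PO n} → (Fin (n * suc (size B)) → Fin (suc N)) →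
    (Carrier A → Carrier (grid n)) → Set
  Subsequence {n} {A} {B} s u = ∃[ ψ ] ψ Preserves _<ᶠ_ ⟶ _<ᶠ_ ×
    gridMap A (blockCoordinates A (s ∘ ψ)) ≗ u

  factorsThrough-gridCopy⇒subsequence : {A B : PO n} (i₀ : Fin n)
    (s : Fin (n * suc (size B)) → Fin (suc N)) (s-mono : s Preserves _<ᶠ_ ⟶ _<ᶠ_)
    (f : Embedding A (grid n)) (h : Carrier A → Carrier B) →
    fun (gridCopy B i₀ s s-mono) ∘ h ≗ fun f → Subsequence {A = A} {B} s (fun f)
  factorsThrough-gridCopy⇒subsequence {n} {A} {B} i₀ s s-mono f h g∘h≗f =
    blockwise φ , blockwise-mono φ φ-mono , gridMap∘ψ≗f
    where
    g : Embedding B (grid n)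
    g = gridCopy B i₀ s s-mono
    h-mono : ∀ i → h Preserves realizer A i ⟶ realizer B i
    h-mono i x<y = Equivalence.from (pres-i g i _ _) (subst₂ (realizer (grid n) i)
      (sym (g∘h≗f _)) (sym (g∘h≗f _)) (Equivalence.to (pres-i f i _ _) x<y))
    φ : Fin n → Carrier A → Carrier B
    φ i = rank B i ∘ h ∘ Rank.unrank (isLinear A i)
    φ-mono : ∀ i → φ i Preserves _<ᶠ_ ⟶ _<ᶠ_
    φ-mono i = Rank.rank-mono (isLinear B i) ∘ h-mono i ∘ Rank.unrank-mono (isLinear A i)
    gridMap∘ψ≗f : gridMap A (blockCoordinates A (s ∘ blockwise φ)) ≗ fun f
    gridMap∘ψ≗f x = begin
      encode (λ i → s (blockwise φ (combine i (rank A i x))))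
        ≡⟨ encode-cong (λ i → cong s (blockwise-combine φ i (rank A i x))) ⟩
      encode (λ i → s (combine i (rank B i (h (Rank.unrank (isLinear A i) (rank A i x))))))
        ≡⟨ encode-cong (λ i → cong (λ y → s (combine i (rank B i (h y))))
                                   (Rank.unrank-rank (isLinear A i) x)) ⟩
      fun g (h x)
        ≡⟨ g∘h≗f x ⟩
      fun f x ∎
      where open ≡-Reasoning

  ⊆gridCopy⇒subsequence : {A B : PO n} (i₀ : Fin n)
    (s : Fin (n * suc (size B)) → Fin (suc N)) (s-mono : s Preserves _<ᶠ_ ⟶ _<ᶠ_)
    (f : Embedding A (grid n)) → image f ⊆ image (gridCopy B i₀ s s-mono) →
    Subsequence {A = A} {B} s (fun f)
  ⊆gridCopy⇒subsequence {A = A} {B} i₀ s s-mono f f⊆g =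
    factorsThrough-gridCopy⇒subsequence {A = A} {B} i₀ s s-mono f
      (proj₁ ∘ preimage) (proj₂ ∘ preimage)
    where
    preimage : ∀ x → ∃[ y ] fun (gridCopy B i₀ s s-mono) y ≡ fun f x
    preimage x = Equivalence.to (∈-imageOf _)
      (f⊆g (Equivalence.from (∈-imageOf (fun f)) (x , refl)))

⊑allFin⇒lookup-mono : {M : List (Fin m)} → M ⊑ allFin m → (len : length M ≡ n) →
  (lookup M ∘ cast (sym len)) Preserves _<ᶠ_ ⟶ _<ᶠ_
⊑allFin⇒lookup-mono M⊑ len = AllPairs⇒lookup-mono (AllPairs-resp-⊑ (tabulate⁺-< id) M⊑) ∘ cast-mono

module Construction (i₀ : Fin n) (A B : PO n) (k : ℕ) where

  ∣A∣ ∣B∣ : ℕ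
  ∣A∣ = suc (size A)
  ∣B∣ = suc (size B)

  -- Opaque: the Ramsey number is astronomically large, and unfolding it stalls type checking.
  opaque
    ramseyNumber : ℕ
    ramseyNumber = proj₁ (ramsey (n * ∣A∣) (suc k) (n * ∣B∣))

    ramseyNumber-ramsey : RamseyProperty (n * ∣A∣) (suc k) (n * ∣B∣) ramseyNumber
    ramseyNumber-ramsey = proj₂ (ramsey (n * ∣A∣) (suc k) (n * ∣B∣))

  N : ℕ
  N = n * ∣B∣ + ramseyNumber

  open Grid N

  embedB : Embedding B (grid n)
  embedB = gridCopy B i₀ (λ p → inject≤ p (ℕ.m≤n⇒m≤1+n (ℕ.m≤m+n _ _)))
    λ {p} {q} → subst₂ _<_ (sym (toℕ-inject≤ p _)) (sym (toℕ-inject≤ q _))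

  colouring : (Subset (suc (gridSize n)) → Fin (suc k)) → Colouring (n * ∣A∣)
  colouring c Z len =
    toℕ (c (imageOf (gridMap A (blockCoordinates A (lookup Z ∘ cast (sym len))))))

  homogeneousCopy : (c : Subset (suc (gridSize n)) → Fin (suc k)) →
    Σ (Subset (suc (gridSize n))) (λ B₀ → Copy B (grid n) B₀
      × Σ (Fin (suc k)) (λ col → (S : Subset (suc (gridSize n)))
          → Copy A (grid n) S → S ⊆ B₀ → c S ≡ col))
  homogeneousCopy c
    with ramseyNumber-ramsey (allFin (suc N)) allFin-long (colouring c) (λ _ _ → toℕ<n _)
    where
    allFin-long : ramseyNumber ≤ length (allFin (suc N))
    allFin-long = subst (ramseyNumber ≤_) (sym (length-tabulate {n = suc N} id))
      (ℕ.m≤n⇒m≤1+n (ℕ.m≤n+m _ _))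
  ... | M , M⊑L , lenM , col , col<K , hom =
    image g , (g , refl) , fromℕ< col<K , λ S (f , imf≡S) S⊆B₀ →
      toℕ-injective (trans (copy-colour S f imf≡S S⊆B₀) (sym (toℕ-fromℕ< col<K)))
    where
    s : Fin (n * ∣B∣) → Fin (suc N)
    s = lookup M ∘ cast (sym lenM)
    s-mono : s Preserves _<ᶠ_ ⟶ _<ᶠ_
    s-mono = ⊑allFin⇒lookup-mono M⊑L lenM
    g : Embedding B (grid n)
    g = gridCopy B i₀ s s-mono
    copy-colour : ∀ S (f : Embedding A (grid n)) → image f ≡ S → S ⊆ image g → toℕ (c S) ≡ col
    copy-colour S f refl S⊆B₀ =
      subsequence-colour (⊆gridCopy⇒subsequence {A = A} {B} i₀ s s-mono f S⊆B₀)
      where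
      subsequence-colour : Subsequence {A = A} {B} s (fun f) → toℕ (c (image f)) ≡ col
      subsequence-colour (ψ , ψ-mono , ψ-copy) = begin
        toℕ (c (image f))                        ≡⟨ cong (toℕ ∘ c) (imageOf-cong Z-copy) ⟨
        colouring c Z (length-tabulate (s ∘ ψ))  ≡⟨ hom Z Z⊑M (length-tabulate (s ∘ ψ)) ⟩
        col                                      ∎
        where
        open ≡-Reasoning
        Z : List (Fin (suc N))
        Z = tabulate (s ∘ ψ)
        Z⊑M : Z ⊑ M
        Z⊑M = tabulate-lookup-⊑ M (cast (sym lenM) ∘ ψ) (cast-mono ∘ ψ-mono)
        Z-copy : gridMap A (blockCoordinates A (lookup Z ∘ cast (sym (length-tabulate (s ∘ ψ)))))
                 ≗ fun f
        Z-copy x = trans (gridMap-blockCoordinates-cong A (lookup-tabulate (s ∘ ψ)) x) (ψ-copy x)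

-- One realizer index suffices to make grid maps injective, and the construction does not need
-- the embedding of A into B.
theorem5p3 : (n : ℕ) → 2 ≤ n → (A B : PO n) → Embedding A B → (k : ℕ)
    → Σ (PO n) (λ C → Embedding B C
    × ((c : Subset (suc (size C)) → Fin (suc k))
    → Σ (Subset (suc (size C))) (λ B₀ → Copy B C B₀
    × Σ (Fin (suc k)) (λ col → (S : Subset (suc (size C)))
    → Copy A C S → S ⊆ B₀ → c S ≡ col))))
theorem5p3 n 2≤n A B _ k = Grid.grid N n , embedB , homogeneousCopy
  where open Construction (fromℕ< 2≤n) A B k
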